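{- Let $s,k$ be coprime positive integers with $s\ge2$. For all $x\in\mathcal{P}$, we have $\lfloor x/s\rfloor+1=|\langle x\rangle\cap\mathcal{E}|$.
   Context: Let $\mathcal{P}=\mathbb{Z}_{>0}\setminus\{as+b(s+k) : a,b\in\mathbb{Z}_{\ge0}\}$, partially ordered by $<_{\mathcal{P}}$, the transitive closure of the relation $x\lessdot y$ iff $y-x\in\{s,s+k\}$ (for $x,y\in\mathcal{P}$). For $x\in\mathcal{P}$, $\langle x\rangle=\{y\in\mathcal{P}: y=x \text{ or } y<_{\mathcal{P}}x\}$ is the order ideal generated by $x$. Let $\mathcal{E}=\mathcal{P}\cap\{1,\dots,s+k-1\}$. -}

module Defs where

open import Data.Nat using (ℕ; _+_; _*_; _<_)
open import Data.Product using (_×_; ∃₂)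
open import Data.Sum using (_⊎_)
open import Relation.Nullary using (¬_)
open import Relation.Binary.PropositionalEquality using (_≡_)
open import Relation.Binary.Construct.Closure.Transitive using (TransClosure)

InSemigroup : ℕ → ℕ → ℕ → Set
InSemigroup s k n = ∃₂ λ a b → n ≡ a * s + b * (s + k)

InP : ℕ → ℕ → ℕ → Set
InP s k n = (0 < n) × ¬ InSemigroup s k n

Cover : ℕ → ℕ → ℕ → ℕ → Set
Cover s k x y = InP s k x × InP s k y × ((y ≡ x + s) ⊎ (y ≡ x + (s + k)))

_<P[_,_]_ : ℕ → ℕ → ℕ → ℕ → Set
x <P[ s , k ] y = TransClosure (Cover s k) x y

InIdeal : ℕ → ℕ → ℕ → ℕ → Set
InIdeal s k x y = InP s k y × ((y ≡ x) ⊎ (y <P[ s , k ] x))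

InE : ℕ → ℕ → ℕ → Set
InE s k y = InP s k y × (y < s + k)

{-# OPTIONS --safe #-}
module Submission where

-- Writing g = s + k, an element y of 𝒫 lies below x exactly when
-- x = y + a s + b g for some a, b ≥ 0, and it lies in ℰ when moreover
-- y < g; then y is the remainder of x - a s modulo g.  So ⟨x⟩ ∩ ℰ is the
-- set of remainders (x - a s) mod g for a = 0, …, ⌊x/s⌋.  Since s is
-- invertible modulo g, these remainders are pairwise distinct as long as
-- ⌊x/s⌋ < g; and that bound holds, for otherwise g nonzero remainders
-- (x - a s) mod g, a < g, would be pairwise distinct values in 1, …, g - 1.

open import Defs
open import Data.Nat using (ℕ; zero; suc; _+_; _*_; _∸_; _/_; _%_; _≤_; _<_; NonZero;
  s≤s; z<s; >-nonZero; >-nonZero⁻¹)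
open import Data.Nat.Properties
open import Algebra.Properties.CommutativeSemigroup +-commutativeSemigroup using (xy∙z≈xz∙y)
open import Data.Nat.DivMod using (m≡m%n+[m/n]*n; [m+kn]%n≡m%n; m<n⇒m%n≡m; m%n<n;
  m/n*n≤m; m*n/n≡m; /-monoˡ-≤)
open import Data.Nat.Divisibility using (_∣_; divides; ∣⇒≤)
open import Data.Nat.Coprimality using (Coprime; coprime-+; coprime-divisor)
import Data.Nat.Coprimality as Coprimality
open import Data.Nat.Solver using (module +-*-Solver)
open +-*-Solver using (solve; _:+_; _:*_; _:=_; con)
open import Data.Fin using (toℕ; fromℕ<)
open import Data.Fin.Properties using (pigeonhole; toℕ<n; fromℕ<-injective)
open import Data.Product using (Σ; _×_; _,_; proj₁; ∃₂)
open import Data.Sum using (_⊎_; inj₁; inj₂)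
open import Data.Empty using (⊥-elim)
open import Data.List using (List; length; applyUpTo)
open import Data.List.Properties using (length-applyUpTo)
open import Data.List.Membership.Propositional using (_∈_)
open import Data.List.Membership.Propositional.Properties using (∈-applyUpTo⁺; ∈-applyUpTo⁻)
open import Data.List.Relation.Unary.Unique.Propositional using (Unique)
open import Data.List.Relation.Unary.Unique.Propositional.Properties using (applyUpTo⁺₁)
open import Relation.Binary.Construct.Closure.Transitive using ([_]; _∷_)
open import Relation.Nullary using (¬_)
open import Function using (_∘′_)
open import Function.Bundles using (_⇔_; mk⇔; Equivalence)
open import Relation.Binary.PropositionalEquality

pigeonhole-ℕ : ∀ {m n} → m < n → (h : ℕ → ℕ) → (∀ {i} → i < n → h i < m) →
               ∃₂ λ i j → i < j × j < n × h i ≡ h j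
pigeonhole-ℕ m<n h h< with i , j , i<j , eq ← pigeonhole m<n (λ i → fromℕ< (h< (toℕ<n i)))
  = toℕ i , toℕ j , i<j , toℕ<n j , fromℕ<-injective _ _ _ _ eq

[m+n]%d≡m%d⇒d∣n : ∀ m n d .{{_ : NonZero d}} → (m + n) % d ≡ m % d → d ∣ n
[m+n]%d≡m%d⇒d∣n m n d eq = divides ((m + n) / d ∸ m / d) (begin
  n                                                       ≡⟨ m+n∸m≡n m n ⟨
  (m + n) ∸ m                                             ≡⟨ cong₂ _∸_ (m≡m%n+[m/n]*n (m + n) d) (m≡m%n+[m/n]*n m d) ⟩
  ((m + n) % d + (m + n) / d * d) ∸ (m % d + m / d * d)   ≡⟨ cong (λ r → (r + (m + n) / d * d) ∸ (m % d + m / d * d)) eq ⟩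
  (m % d + (m + n) / d * d) ∸ (m % d + m / d * d)         ≡⟨ [m+n]∸[m+o]≡n∸o (m % d) _ _ ⟩
  (m + n) / d * d ∸ m / d * d                             ≡⟨ *-distribʳ-∸ d ((m + n) / d) (m / d) ⟨
  ((m + n) / d ∸ m / d) * d                               ∎)
  where open ≡-Reasoning

Reachable : ℕ → ℕ → ℕ → ℕ → Set
Reachable s k y x = ∃₂ λ a b → x ≡ y + a * s + b * (s + k)

module _ {s k : ℕ} where

  Reachable-refl : ∀ {x} → Reachable s k x x
  Reachable-refl {x} = 0 , 0 , solve 1 (λ x → x := x :+ con 0 :+ con 0) refl x

  Reachable-trans : ∀ {x y z} → Reachable s k x y → Reachable s k y z → Reachable s k x z
  Reachable-trans {x} (a , b , refl) (a′ , b′ , refl) = a + a′ , b + b′ ,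
    solve 7 (λ x a b a′ b′ s k → x :+ a :* s :+ b :* (s :+ k) :+ a′ :* s :+ b′ :* (s :+ k)
                              := x :+ (a :+ a′) :* s :+ (b :+ b′) :* (s :+ k)) refl x a b a′ b′ s k

  InSemigroup-reach : ∀ {x y} → Reachable s k y x → InSemigroup s k y → InSemigroup s k x
  InSemigroup-reach y↝x (a , b , refl) = Reachable-trans (a , b , refl) y↝x

  InP-downward : ∀ {x y} → InP s k x → Reachable s k y x → InP s k y
  InP-downward {y = zero}  (_ , x∉S) 0↝x = ⊥-elim (x∉S (InSemigroup-reach 0↝x (0 , 0 , refl)))
  InP-downward {y = suc _} (_ , x∉S) y↝x = z<s , x∉S ∘′ InSemigroup-reach y↝x

  Cover⇒Reachable : ∀ {x y} → Cover s k y x → Reachable s k y x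
  Cover⇒Reachable {y = y} (_ , _ , inj₁ refl) = 1 , 0 , solve 3 (λ y s k → y :+ s := y :+ con 1 :* s :+ con 0 :* (s :+ k)) refl y s k
  Cover⇒Reachable {y = y} (_ , _ , inj₂ refl) = 0 , 1 , solve 3 (λ y s k → y :+ (s :+ k) := y :+ con 0 :* s :+ con 1 :* (s :+ k)) refl y s k

  <P⇒Reachable : ∀ {x y} → y <P[ s , k ] x → Reachable s k y x
  <P⇒Reachable [ y⋖x ]      = Cover⇒Reachable y⋖x
  <P⇒Reachable (y⋖z ∷ z<x) = Reachable-trans (Cover⇒Reachable y⋖z) (<P⇒Reachable z<x)

  Cover-◅ : ∀ {x y z} → Cover s k y z → (z ≡ x) ⊎ (z <P[ s , k ] x) → y <P[ s , k ] x
  Cover-◅ y⋖x (inj₁ refl) = [ y⋖x ]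
  Cover-◅ y⋖z (inj₂ z<x)  = y⋖z ∷ z<x

  Reachable⇒≤P : ∀ {x} → InP s k x → ∀ a b y → x ≡ y + a * s + b * (s + k) →
                 (y ≡ x) ⊎ (y <P[ s , k ] x)
  Reachable⇒≤P x∈𝒫 zero zero y refl = inj₁ (solve 1 (λ y → y := y :+ con 0 :+ con 0) refl y)
  Reachable⇒≤P {x} x∈𝒫 (suc a) b y eq = inj₂ (Cover-◅ y⋖y+s (Reachable⇒≤P x∈𝒫 a b (y + s) eq′))
    where
    eq′ : x ≡ y + s + a * s + b * (s + k)
    eq′ = trans eq (solve 5 (λ y a b s k → y :+ (con 1 :+ a) :* s :+ b :* (s :+ k)
                                        := y :+ s :+ a :* s :+ b :* (s :+ k)) refl y a b s k)
    y⋖y+s : Cover s k y (y + s)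
    y⋖y+s = InP-downward x∈𝒫 (suc a , b , eq) , InP-downward x∈𝒫 (a , b , eq′) , inj₁ refl
  Reachable⇒≤P {x} x∈𝒫 zero (suc b) y eq = inj₂ (Cover-◅ y⋖y+g (Reachable⇒≤P x∈𝒫 0 b (y + (s + k)) eq′))
    where
    eq′ : x ≡ y + (s + k) + 0 * s + b * (s + k)
    eq′ = trans eq (solve 4 (λ y b s k → y :+ con 0 :* s :+ (con 1 :+ b) :* (s :+ k)
                                      := y :+ (s :+ k) :+ con 0 :* s :+ b :* (s :+ k)) refl y b s k)
    y⋖y+g : Cover s k y (y + (s + k))
    y⋖y+g = InP-downward x∈𝒫 (0 , suc b , eq) , InP-downward x∈𝒫 (0 , b , eq′) , inj₂ refl

  InIdeal⇔Reachable : ∀ {x y} → InP s k x → InIdeal s k x y ⇔ Reachable s k y x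
  InIdeal⇔Reachable {x} {y} x∈𝒫 = mk⇔ to from
    where
    to : InIdeal s k x y → Reachable s k y x
    to (_ , inj₁ refl) = Reachable-refl
    to (_ , inj₂ y<x)  = <P⇒Reachable y<x
    from : Reachable s k y x → InIdeal s k x y
    from (a , b , eq) = InP-downward x∈𝒫 (a , b , eq) , Reachable⇒≤P x∈𝒫 a b y eq

module Residues (s k : ℕ) .{{_ : NonZero s}} (s⊥k : Coprime s k) (x : ℕ) (x∈𝒫 : InP s k x) where

  g : ℕ
  g = s + k

  instance
    g≢0 : NonZero g
    g≢0 = >-nonZero (<-≤-trans (>-nonZero⁻¹ s) (m≤m+n s k))

  residue : ℕ → ℕ
  residue a = (x ∸ a * s) % g

  residue-reaches : ∀ a → a * s ≤ x → Reachable s k (residue a) x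
  residue-reaches a as≤x = a , (x ∸ a * s) / g , (begin
    x                                             ≡⟨ m∸n+n≡m as≤x ⟨
    x ∸ a * s + a * s                             ≡⟨ cong (_+ a * s) (m≡m%n+[m/n]*n (x ∸ a * s) g) ⟩
    residue a + (x ∸ a * s) / g * g + a * s       ≡⟨ xy∙z≈xz∙y (residue a) _ (a * s) ⟩
    residue a + a * s + (x ∸ a * s) / g * g       ∎)
    where open ≡-Reasoning

  residue-∈𝒫 : ∀ a → a * s ≤ x → InP s k (residue a)
  residue-∈𝒫 a as≤x = InP-downward x∈𝒫 (residue-reaches a as≤x)

  Reachable⇒residue : ∀ {y} a b → y < g → x ≡ y + a * s + b * g → residue a ≡ y
  Reachable⇒residue {y} a b y<g refl = begin
    (y + a * s + b * g ∸ a * s) % g     ≡⟨ cong (λ n → (n ∸ a * s) % g) (xy∙z≈xz∙y y (a * s) (b * g)) ⟩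
    (y + b * g + a * s ∸ a * s) % g     ≡⟨ cong (_% g) (m+n∸n≡m (y + b * g) (a * s)) ⟩
    (y + b * g) % g                     ≡⟨ [m+kn]%n≡m%n y b g ⟩
    y % g                               ≡⟨ m<n⇒m%n≡m y<g ⟩
    y                                   ∎
    where open ≡-Reasoning

  residue-injective : ∀ {i j} → i < j → j < g → j * s ≤ x → residue i ≢ residue j
  residue-injective {i} {j} i<j j<g js≤x ri≡rj = <⇒≱ (≤-<-trans (m∸n≤m j i) j<g) g≤j∸i
    where
    open ≡-Reasoning
    shift : x ∸ i * s ≡ x ∸ j * s + (j ∸ i) * s
    shift = begin
      x ∸ i * s                          ≡⟨ cong (_∸ i * s) (m∸n+n≡m js≤x) ⟨
      x ∸ j * s + j * s ∸ i * s          ≡⟨ +-∸-assoc (x ∸ j * s) (*-monoˡ-≤ s (<⇒≤ i<j)) ⟩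
      x ∸ j * s + (j * s ∸ i * s)        ≡⟨ cong (x ∸ j * s +_) (*-distribʳ-∸ s j i) ⟨
      x ∸ j * s + (j ∸ i) * s            ∎
    g∣[j∸i]*s : g ∣ (j ∸ i) * s
    g∣[j∸i]*s = [m+n]%d≡m%d⇒d∣n (x ∸ j * s) ((j ∸ i) * s) g (trans (cong (_% g) (sym shift)) ri≡rj)
    g∣j∸i : g ∣ j ∸ i
    g∣j∸i = coprime-divisor (coprime-+ (Coprimality.sym s⊥k)) (subst (g ∣_) (*-comm (j ∸ i) s) g∣[j∸i]*s)
    g≤j∸i : g ≤ j ∸ i
    g≤j∸i = ∣⇒≤ {{>-nonZero (m<n⇒0<n∸m i<j)}} g∣j∸i

  ≤quotient⇒*≤ : ∀ {a} → a ≤ x / s → a * s ≤ x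
  ≤quotient⇒*≤ a≤q = ≤-trans (*-monoˡ-≤ s a≤q) (m/n*n≤m x s)

  *≤⇒≤quotient : ∀ {a} → a * s ≤ x → a ≤ x / s
  *≤⇒≤quotient {a} as≤x = subst (_≤ x / s) (m*n/n≡m a s) (/-monoˡ-≤ s as≤x)

  quotient<g : x / s < g
  quotient<g = ≰⇒> g≰quotient
    where
    g≰quotient : ¬ g ≤ x / s
    g≰quotient g≤q =
      let i , j , i<j , j<g , eq = pigeonhole-ℕ (∸-monoʳ-< z<s (>-nonZero⁻¹ g)) (λ a → residue a ∸ 1) bounded
      in  residue-injective i<j j<g (fits j<g) (∸-cancelʳ-≡ (positive (<-trans i<j j<g)) (positive j<g) eq)
      where
      fits : ∀ {a} → a < g → a * s ≤ x
      fits a<g = ≤quotient⇒*≤ (≤-trans (<⇒≤ a<g) g≤q)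
      positive : ∀ {a} → a < g → 1 ≤ residue a
      positive {a} a<g = proj₁ (residue-∈𝒫 a (fits a<g))
      bounded : ∀ {a} → a < g → residue a ∸ 1 < g ∸ 1
      bounded a<g = ∸-monoˡ-< (m%n<n _ g) (positive a<g)

  residues : List ℕ
  residues = applyUpTo residue (suc (x / s))

  residues-unique : Unique residues
  residues-unique = applyUpTo⁺₁ residue _ λ i<j j≤q →
    residue-injective i<j (≤-<-trans (m<1+n⇒m≤n j≤q) quotient<g) (≤quotient⇒*≤ (m<1+n⇒m≤n j≤q))

  residue-∈ideal∩ℰ : ∀ {a} → a ≤ x / s → InIdeal s k x (residue a) × InE s k (residue a)
  residue-∈ideal∩ℰ {a} a≤q = Equivalence.from (InIdeal⇔Reachable x∈𝒫) (residue-reaches a as≤x) ,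
                             residue-∈𝒫 a as≤x , m%n<n _ g
    where
    as≤x : a * s ≤ x
    as≤x = ≤quotient⇒*≤ a≤q

  Reachable⇒∈residues : ∀ {y} → Reachable s k y x → y < g → y ∈ residues
  Reachable⇒∈residues {y} (a , b , eq) y<g =
    subst (_∈ residues) (Reachable⇒residue a b y<g eq) (∈-applyUpTo⁺ residue {a} (s≤s (*≤⇒≤quotient as≤x)))
    where
    as≤x : a * s ≤ x
    as≤x = subst (a * s ≤_) (sym eq) (≤-trans (m≤n+m (a * s) y) (m≤m+n (y + a * s) (b * g)))

  ∈residues⇔ : ∀ {y} → y ∈ residues ⇔ (InIdeal s k x y × InE s k y)
  ∈residues⇔ = mk⇔ to from
    where
    to : ∀ {y} → y ∈ residues → InIdeal s k x y × InE s k y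
    to mem with _ , a<1+q , refl ← ∈-applyUpTo⁻ residue mem = residue-∈ideal∩ℰ (m<1+n⇒m≤n a<1+q)
    from : ∀ {y} → InIdeal s k x y × InE s k y → y ∈ residues
    from (y∈⟨x⟩ , _ , y<g) = Reachable⇒∈residues (Equivalence.to (InIdeal⇔Reachable x∈𝒫) y∈⟨x⟩) y<g

lemma3p5 : (s k : ℕ) → .{{_ : NonZero s}} → 2 ≤ s → 0 < k → Coprime s k →
    (x : ℕ) → InP s k x →
    Σ (List ℕ) λ L → Unique L
    × ((y : ℕ) → (y ∈ L) ⇔ (InIdeal s k x y × InE s k y))
    × (length L ≡ x / s + 1)
lemma3p5 s k _ _ s⊥k x x∈𝒫 =
  residues , residues-unique , (λ _ → ∈residues⇔) , trans (length-applyUpTo residue _) (+-comm 1 (x / s))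
  where open Residues s k s⊥k x x∈𝒫
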